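{- $\mathcal{H}$ is a dcpo. More precisely, for every $m\in\mathbb{N}$, $s\in\mathbb{N}^*$ and every infinite subset $N\subseteq\mathbb{N}$, the chain $\{(m,n{:}s)\mid n\in N\}$ has supremum $(m,s)$ in $\mathcal{H}$.
   Context: Let $\mathbb{N}^*$ be the set of finite strings of natural numbers; $\varepsilon$ is the empty string, $n{:}s$ is $s$ with $n$ put in front, $ts$ is concatenation, and for nonempty $t$, $\min(t)$ is its least entry. On $\mathbb{N}\times\mathbb{N}^*$ define, for $m,m',n,n'\in\mathbb{N}$, $s,t\in\mathbb{N}^*$: $(m,n{:}s)<_1(m,n'{:}s)$ if $n<n'$; $(m,ts)<_2(m,s)$ if $t\neq\varepsilon$; $(m,ts)<_3(m',s)$ if $t\ne\varepsilon$ and $\min(t)\le m'$. Let $<\;=\;<_1\cup<_2\cup<_3\cup(<_2;<_1)\cup(<_3;<_1)$ ($x\,(R;R')\,z$ iff $\exists y$, $x\,R\,y$, $y\,R'\,z$) and $\le\;=\;<\cup=$, a partial order; $\mathcal{H}=(\mathbb{N}\times\mathbb{N}^*,\le)$. -}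

module Defs where

open import Data.Nat using (ℕ; _<_; _≤_; _⊓_)
open import Data.List using (List; []; _∷_; _++_; foldr)
open import Data.Product using (_×_; _,_; ∃; ∃-syntax; Σ)
open import Data.Sum using (_⊎_)
open import Relation.Binary.PropositionalEquality using (_≡_)

ℕ* : Set
ℕ* = List ℕ

H : Set
H = ℕ × ℕ*

minNE : ℕ → List ℕ → ℕ
minNE k t = foldr _⊓_ k t

data _<₁_ : H → H → Set where
  lt₁ : ∀ {m n n' s} → n < n' → (m , n ∷ s) <₁ (m , n' ∷ s)

data _<₂_ : H → H → Set where
  lt₂ : ∀ {m k t s} → (m , (k ∷ t) ++ s) <₂ (m , s)

data _<₃_ : H → H → Set where
  lt₃ : ∀ {m m' k t s} → minNE k t ≤ m' → (m , (k ∷ t) ++ s) <₃ (m' , s)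

_⨾_ : (H → H → Set) → (H → H → Set) → H → H → Set
(R ⨾ R') x z = ∃[ y ] (R x y × R' y z)

_<H_ : H → H → Set
x <H y = x <₁ y ⊎ x <₂ y ⊎ x <₃ y ⊎ (_<₂_ ⨾ _<₁_) x y ⊎ (_<₃_ ⨾ _<₁_) x y

_≤H_ : H → H → Set
x ≤H y = x <H y ⊎ x ≡ y

Directed : (H → Set) → Set
Directed D = (∃[ x ] D x)
           × (∀ x y → D x → D y → ∃[ z ] (D z × x ≤H z × y ≤H z))

IsSup : (H → Set) → H → Set
IsSup D x = (∀ y → D y → y ≤H x)
          × (∀ u → (∀ y → D y → y ≤H u) → x ≤H u)

IsDcpo : Set₁
IsDcpo = ∀ (D : H → Set) → Directed D → ∃[ x ] IsSup D x

Infinite : (ℕ → Set) → Set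
Infinite N = ∀ k → ∃[ n ] (k ≤ n × N n)

chain : ℕ → ℕ* → (ℕ → Set) → H → Set
chain m s N x = ∃[ n ] (N n × x ≡ (m , n ∷ s))

-- Every strict comparison in 𝓗 is a composite of a "strip" (delete a nonempty prefix t
-- while moving from level m to m', allowed when m ≡ m' or some entry of t is ≤ m')
-- followed by at most one increase of the head, and such composites are closed under
-- composition; hence ≤ is transitive and, apart from head increases, strictly shortens
-- the string.
--
-- For the chain {(m , n ∷ s) | n ∈ N}: if (m' , v) bounds it, pick n ∈ N larger than m'
-- and than every entry of v. Then (m , n ∷ s) ≤ (m' , v) can neither be an equality nor
-- a head increase, and the head n cannot be the entry that licenses the strip, so the
-- same comparison still holds with n removed: (m , s) ≤ (m' , v).
--
-- For a directed D (classically), take z ∈ D with shortest string. Any upper bound in D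
-- of z is z itself or a head increase of z, so D is cofinal in the chain through z. That
-- chain has a largest element or is infinite, and in the latter case its supremum is
-- the one found above.
module Submission where

open import Defs
open import Data.Nat using (ℕ; zero; suc; _+_; _<_; _≤_; _⊓_; s≤s; s≤s⁻¹)
open import Data.Nat.Properties
open import Data.Nat.ListAction using (sum)
open import Data.Nat.Induction using (<-wellFounded; Acc; acc)
open import Data.List using (List; []; _∷_; _++_; length)
open import Data.List.Properties using (length-++; ++-assoc; foldr-preservesᵒ)
open import Data.List.Membership.Propositional.Properties using (foldr-selective)
open import Data.List.Relation.Unary.Any as Any using (Any; here; there)
open import Data.List.Relation.Unary.Any.Properties using (++⁺ˡ; ++⁺ʳ)
open import Data.Product using (_×_; _,_; ∃; ∃-syntax)
open import Data.Sum using (_⊎_; inj₁; inj₂)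
open import Data.Empty using (⊥-elim)
open import Relation.Nullary using (yes; no)
open import Relation.Binary.PropositionalEquality using (_≡_; refl; sym; subst)
open import Relation.Binary.Construct.Closure.Reflexive using (ReflClosure; refl; [_])
import Relation.Binary.Construct.Closure.Reflexive.Properties as ReflClosure
open import Axiom.ExcludedMiddle using (ExcludedMiddle)
import Level

minNE≤⇒Any≤ : ∀ {x} k t → minNE k t ≤ x → Any (_≤ x) (k ∷ t)
minNE≤⇒Any≤ k t min≤x with foldr-selective ⊓-sel k t
... | inj₁ min≡k = here (subst (_≤ _) min≡k min≤x)
... | inj₂ min∈t = there (Any.map (λ { refl → min≤x }) min∈t)

⊓-≤-either : ∀ {x} a b → a ≤ x ⊎ b ≤ x → a ⊓ b ≤ x
⊓-≤-either a b (inj₁ a≤x) = m≤n⇒m⊓o≤n b a≤x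
⊓-≤-either a b (inj₂ b≤x) = m≤n⇒o⊓m≤n a b≤x

Any≤⇒minNE≤ : ∀ {x} k t → Any (_≤ x) (k ∷ t) → minNE k t ≤ x
Any≤⇒minNE≤ k t k∷t≤x = foldr-preservesᵒ ⊓-≤-either k t (Any.toSum k∷t≤x)

Strippable : ℕ → ℕ* → ℕ → Set
Strippable m t m' = m ≡ m' ⊎ Any (_≤ m') t

Strippable-++ : ∀ {m m' m'' t u} →
                Strippable m t m' → Strippable m' u m'' → Strippable m (t ++ u) m''
Strippable-++ (inj₁ refl) (inj₁ refl) = inj₁ refl
Strippable-++ {t = t} _   (inj₂ u≤)   = inj₂ (++⁺ʳ t u≤)
Strippable-++ (inj₂ t≤)   (inj₁ refl) = inj₂ (++⁺ˡ t≤)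

Strippable-lowerHead : ∀ {m m' n n' t} → n ≤ n' → Strippable m (n' ∷ t) m' → Strippable m (n ∷ t) m'
Strippable-lowerHead n≤n' (inj₁ m≡m')        = inj₁ m≡m'
Strippable-lowerHead n≤n' (inj₂ (here n'≤))  = inj₂ (here (≤-trans n≤n' n'≤))
Strippable-lowerHead n≤n' (inj₂ (there t≤))  = inj₂ (there t≤)

Strippable-dropHead : ∀ {m m' n t} → m' < n → Strippable m (n ∷ t) m' → Strippable m t m'
Strippable-dropHead m'<n (inj₁ m≡m')       = inj₁ m≡m'
Strippable-dropHead m'<n (inj₂ (here n≤m')) = ⊥-elim (<⇒≱ m'<n n≤m')
Strippable-dropHead m'<n (inj₂ (there t≤))  = inj₂ t≤

Strippable-[] : ∀ {m m'} → Strippable m [] m' → m ≡ m'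
Strippable-[] (inj₁ m≡m') = m≡m'
Strippable-[] (inj₂ ())

-- _<H_ in normal form: <₂ and <₃ merge into one strip step, with the min condition
-- recast via Any; unlike _<H_, this form is closed under composition.
data _⊏_ : H → H → Set where
  strip      : ∀ {m m' k t v} → Strippable m (k ∷ t) m' → (m , (k ∷ t) ++ v) ⊏ (m' , v)
  bump       : ∀ {m n n' s} → n < n' → (m , n ∷ s) ⊏ (m , n' ∷ s)
  strip-bump : ∀ {m m' k t n n' s} → Strippable m (k ∷ t) m' → n < n' →
               (m , (k ∷ t) ++ n ∷ s) ⊏ (m' , n' ∷ s)

strip-strip : ∀ {m m' m'' k t k' t' w} →
              Strippable m (k ∷ t) m' → Strippable m' (k' ∷ t') m'' →
              (m , (k ∷ t) ++ (k' ∷ t') ++ w) ⊏ (m'' , w)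
strip-strip {t = t} {k'} {t'} {w} c c'
  rewrite sym (++-assoc t (k' ∷ t') w) = strip (Strippable-++ c c')

strip-strip-bump : ∀ {m m' m'' k t k' t' n n' s} →
                   Strippable m (k ∷ t) m' → Strippable m' (k' ∷ t') m'' → n < n' →
                   (m , (k ∷ t) ++ (k' ∷ t') ++ n ∷ s) ⊏ (m'' , n' ∷ s)
strip-strip-bump {t = t} {k'} {t'} {n} {s = s} c c' n<n'
  rewrite sym (++-assoc t (k' ∷ t') (n ∷ s)) = strip-bump (Strippable-++ c c') n<n'

⊏-trans : ∀ {x y z} → x ⊏ y → y ⊏ z → x ⊏ z
⊏-trans (strip c)        (strip c')        = strip-strip c c'
⊏-trans (strip c)        (bump p)          = strip-bump c p
⊏-trans (strip c)        (strip-bump c' p) = strip-strip-bump c c' p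
⊏-trans (bump p)         (strip c)         = strip (Strippable-lowerHead (<⇒≤ p) c)
⊏-trans (bump p)         (bump q)          = bump (<-trans p q)
⊏-trans (bump p)         (strip-bump c q)  = strip-bump (Strippable-lowerHead (<⇒≤ p) c) q
⊏-trans (strip-bump c p) (strip c')        = strip-strip c (Strippable-lowerHead (<⇒≤ p) c')
⊏-trans (strip-bump c p) (bump q)          = strip-bump c (<-trans p q)
⊏-trans (strip-bump c p) (strip-bump c' q) = strip-strip-bump c (Strippable-lowerHead (<⇒≤ p) c') q

<H⇒⊏ : ∀ {x y} → x <H y → x ⊏ y
<H⇒⊏ (inj₁ (lt₁ p))                                             = bump p
<H⇒⊏ (inj₂ (inj₁ lt₂))                                          = strip (inj₁ refl)
<H⇒⊏ (inj₂ (inj₂ (inj₁ (lt₃ {k = k} {t} p))))                   = strip (inj₂ (minNE≤⇒Any≤ k t p))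
<H⇒⊏ (inj₂ (inj₂ (inj₂ (inj₁ (_ , lt₂ , lt₁ p)))))              = strip-bump (inj₁ refl) p
<H⇒⊏ (inj₂ (inj₂ (inj₂ (inj₂ (_ , lt₃ {k = k} {t} q , lt₁ p))))) = strip-bump (inj₂ (minNE≤⇒Any≤ k t q)) p

⊏⇒<H : ∀ {x y} → x ⊏ y → x <H y
⊏⇒<H (bump p)                              = inj₁ (lt₁ p)
⊏⇒<H (strip (inj₁ refl))                   = inj₂ (inj₁ lt₂)
⊏⇒<H (strip {k = k} {t} (inj₂ a))          = inj₂ (inj₂ (inj₁ (lt₃ (Any≤⇒minNE≤ k t a))))
⊏⇒<H (strip-bump (inj₁ refl) p)            = inj₂ (inj₂ (inj₂ (inj₁ (_ , lt₂ , lt₁ p))))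
⊏⇒<H (strip-bump {k = k} {t} (inj₂ a) p)   = inj₂ (inj₂ (inj₂ (inj₂ (_ , lt₃ (Any≤⇒minNE≤ k t a) , lt₁ p))))

_⊑_ : H → H → Set
_⊑_ = ReflClosure _⊏_

≤H⇒⊑ : ∀ {x y} → x ≤H y → x ⊑ y
≤H⇒⊑ (inj₁ x<y)  = [ <H⇒⊏ x<y ]
≤H⇒⊑ (inj₂ refl) = refl

⊑⇒≤H : ∀ {x y} → x ⊑ y → x ≤H y
⊑⇒≤H [ x⊏y ] = inj₁ (⊏⇒<H x⊏y)
⊑⇒≤H refl    = inj₂ refl

≤H-trans : ∀ {x y z} → x ≤H y → y ≤H z → x ≤H z
≤H-trans x≤y y≤z = ⊑⇒≤H (ReflClosure.trans ⊏-trans (≤H⇒⊑ x≤y) (≤H⇒⊑ y≤z))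

size : H → ℕ
size (_ , s) = length s

⊏-shortens⊎<₁ : ∀ {x y} → x ⊏ y → size y < size x ⊎ x <₁ y
⊏-shortens⊎<₁ (strip {t = t} {v} _) =
  inj₁ (s≤s (subst (length v ≤_) (sym (length-++ t)) (m≤n+m _ _)))
⊏-shortens⊎<₁ (bump p) = inj₂ (lt₁ p)
⊏-shortens⊎<₁ (strip-bump {t = t} {n} {s = s} _ _) =
  inj₁ (s≤s (subst (suc (length s) ≤_) (sym (length-++ t {n ∷ s})) (m≤n+m _ _)))

⊑-dropLargeHead : ∀ {m m' n s v} → m' < n → sum v < n → (m , n ∷ s) ⊑ (m' , v) → (m , s) ⊑ (m' , v)
⊑-dropLargeHead {n = n} {s} _ sum<n refl = ⊥-elim (<⇒≱ sum<n (m≤m+n n (sum s)))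
⊑-dropLargeHead _ sum<n [ bump {n' = n'} {s} n<n' ] =
  ⊥-elim (<-asym n<n' (≤-<-trans (m≤m+n n' (sum s)) sum<n))
⊑-dropLargeHead m'<n _ [ strip {t = []} c ] with Strippable-[] (Strippable-dropHead m'<n c)
... | refl = refl
⊑-dropLargeHead m'<n _ [ strip {t = _ ∷ _} c ] = [ strip (Strippable-dropHead m'<n c) ]
⊑-dropLargeHead m'<n _ [ strip-bump {t = []} c p ] with Strippable-[] (Strippable-dropHead m'<n c)
... | refl = [ bump p ]
⊑-dropLargeHead m'<n _ [ strip-bump {t = _ ∷ _} c p ] = [ strip-bump (Strippable-dropHead m'<n c) p ]

chain-sup : ∀ {m s N} → Infinite N → IsSup (chain m s N) (m , s)
chain-sup {m} {s} {N} infinite = upper , least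
  where
  upper : ∀ y → chain m s N y → y ≤H (m , s)
  upper _ (_ , _ , refl) = inj₁ (inj₂ (inj₁ (lt₂ {t = []})))

  least : ∀ u → (∀ y → chain m s N y → y ≤H u) → (m , s) ≤H u
  least (m' , v) bounds with infinite (suc (m' + sum v))
  ... | n , large , Nn = ⊑⇒≤H (⊑-dropLargeHead m'<n sum<n (≤H⇒⊑ (bounds _ (n , Nn , refl))))
    where
    m'<n : m' < n
    m'<n = m+n≤o⇒m≤o (suc m') large
    sum<n : sum v < n
    sum<n = ≤-trans (s≤s (m≤n+m (sum v) m')) large

chain-max-sup : ∀ {m s N n₀} → N n₀ → (∀ n → N n → n ≤ n₀) → IsSup (chain m s N) (m , n₀ ∷ s)
chain-max-sup {N = N} Nn₀ maximal = upper , λ _ bounds → bounds _ (_ , Nn₀ , refl)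
  where
  upper : ∀ y → chain _ _ N y → y ≤H _
  upper _ (n , Nn , refl) with m≤n⇒m<n∨m≡n (maximal n Nn)
  ... | inj₁ n<n₀ = inj₁ (inj₁ (lt₁ n<n₀))
  ... | inj₂ refl = inj₂ refl

IsSup-cofinal : ∀ {C D : H → Set} {x} → (∀ {y} → C y → D y) →
                (∀ y → D y → ∃[ w ] (C w × y ≤H w)) → IsSup C x → IsSup D x
IsSup-cofinal C⊆D cofinal (upper , least) =
  (λ y Dy → let w , Cw , y≤w = cofinal y Dy in ≤H-trans y≤w (upper w Cw)) ,
  (λ u bounds → least u (λ y Cy → bounds y (C⊆D Cy)))

shortest-cofinal : ∀ {D : H → Set} {z} → (∀ x y → D x → D y → ∃[ w ] (D w × x ≤H w × y ≤H w)) →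
                   D z → (∀ y → D y → size z ≤ size y) →
                   ∀ y → D y → ∃[ w ] (D w × y ≤H w × (z ≡ w ⊎ z <₁ w))
shortest-cofinal {z = z} directed Dz shortest y Dy with directed y z Dy Dz
... | w , Dw , y≤w , z≤w with ≤H⇒⊑ z≤w
...   | refl = w , Dw , y≤w , inj₁ refl
...   | [ z⊏w ] with ⊏-shortens⊎<₁ z⊏w
...     | inj₁ shorter = ⊥-elim (<⇒≱ shorter (shortest w Dw))
...     | inj₂ z<₁w    = w , Dw , y≤w , inj₂ z<₁w

module Classical (em : ExcludedMiddle Level.zero) where

  least-witness : (P : ℕ → Set) → ∃ P → ∃[ k ] (P k × ∀ j → P j → k ≤ j)
  least-witness P (n , Pn) = go n (<-wellFounded n) Pn
    where
    go : ∀ n → Acc _<_ n → P n → ∃[ k ] (P k × ∀ j → P j → k ≤ j)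
    go n (acc smaller) Pn with em {∃[ j ] (j < n × P j)}
    ... | yes (j , j<n , Pj) = go j (smaller j<n) Pj
    ... | no none            = n , Pn , λ j Pj → ≮⇒≥ (λ j<n → none (j , j<n , Pj))

  shortest : ∀ D → ∃ D → ∃[ z ] (D z × ∀ y → D y → size z ≤ size y)
  shortest D (x , Dx) with least-witness (λ k → ∃[ z ] (D z × size z ≡ k)) (size x , x , Dx , refl)
  ... | _ , (z , Dz , refl) , minimal = z , Dz , λ y Dy → minimal (size y) (y , Dy , refl)

  infinite⊎bounded : ∀ N → Infinite N ⊎ ∃[ b ] (∀ n → N n → n ≤ b)
  infinite⊎bounded N with em {∃[ b ] (∀ n → N n → n ≤ b)}
  ... | yes bounded  = inj₂ bounded
  ... | no unbounded = inj₁ infinite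
    where
    infinite : Infinite N
    infinite k with em {∃[ n ] (k ≤ n × N n)}
    ... | yes found = found
    ... | no none   = ⊥-elim (unbounded (k , λ n Nn → <⇒≤ (≰⇒> (λ k≤n → none (n , k≤n , Nn)))))

  bounded⇒max : ∀ {N n₁} b → (∀ n → N n → n ≤ b) → N n₁ → ∃[ n₀ ] (N n₀ × ∀ n → N n → n ≤ n₀)
  bounded⇒max {N} b bounded Nn₁ with em {N b}
  ... | yes Nb = b , Nb , bounded
  bounded⇒max {N} zero bounded Nn₁ | no ¬N0 = ⊥-elim (¬N0 (subst N (n≤0⇒n≡0 (bounded _ Nn₁)) Nn₁))
  bounded⇒max {N} (suc b) bounded Nn₁ | no ¬Nsb = bounded⇒max b bounded′ Nn₁
    where
    bounded′ : ∀ n → N n → n ≤ b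
    bounded′ n Nn = s≤s⁻¹ (≤∧≢⇒< (bounded n Nn) (λ { refl → ¬Nsb Nn }))

  chain-has-sup : ∀ {m s N n₁} → N n₁ → ∃[ x ] IsSup (chain m s N) x
  chain-has-sup {N = N} Nn₁ with infinite⊎bounded N
  ... | inj₁ infinite = _ , chain-sup infinite
  ... | inj₂ (b , bounded) with bounded⇒max b bounded Nn₁
  ...   | _ , Nn₀ , maximal = _ , chain-max-sup Nn₀ maximal

  column-sup : ∀ {D : H → Set} {z} → D z → (∀ y → D y → ∃[ w ] (D w × y ≤H w × (z ≡ w ⊎ z <₁ w))) →
               ∃[ x ] IsSup D x
  column-sup {D} {m , []} Dz cofinal = _ , upper , λ _ bounds → bounds _ Dz
    where
    upper : ∀ y → D y → y ≤H (m , [])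
    upper y Dy with cofinal y Dy
    ... | _ , _ , y≤z , inj₁ refl = y≤z
  column-sup {D} {m , n₁ ∷ s} Dz cofinal =
    let x , sup = chain-has-sup Dz in x , IsSup-cofinal (λ { (_ , Dn , refl) → Dn }) chain-cofinal sup
    where
    column : H → Set
    column = chain m s (λ n → D (m , n ∷ s))
    chain-cofinal : ∀ y → D y → ∃[ w ] (column w × y ≤H w)
    chain-cofinal y Dy with cofinal y Dy
    ... | w , Dw , y≤w , inj₁ refl     = w , (n₁ , Dw , refl) , y≤w
    ... | w , Dw , y≤w , inj₂ (lt₁ _) = w , (_ , Dw , refl) , y≤w

  dcpo : IsDcpo
  dcpo D (inhabited , directed) =
    let z , Dz , minimal = shortest D inhabited in column-sup Dz (shortest-cofinal directed Dz minimal)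

proposition5p4 : (ExcludedMiddle Level.zero → IsDcpo)
    × (∀ (m : ℕ) (s : ℕ*) (N : ℕ → Set) → Infinite N → IsSup (chain m s N) (m , s))
proposition5p4 = Classical.dcpo , λ _ _ _ → chain-sup
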